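{- Let $(h_k)_{k\ge0}$ be the Fibonacci sequence ($h_0=0$, $h_1=1$, $h_k=h_{k-1}+h_{k-2}$ for $k\ge2$) and let $n$ be a positive even integer. (i) There exist primes $p$ and $q$ such that $\dfrac{h_n}{h_{n-1}}<\dfrac{\log q}{\log p}<\dfrac{h_{n+1}}{h_n}$. (ii) If $p$ and $q$ are primes satisfying the inequalities in (i) and $\alpha=p^{h_{n+1}}/q^{h_n}$, then the characteristic transformation of $\alpha$ is the $2\times(n+1)$ matrix $$T_\alpha=\begin{pmatrix}h_1&h_2&\cdots&h_{n+1}\\ h_0&h_1&\cdots&h_n\end{pmatrix}.$$
   Context: $\mathbb N_0=\{0,1,2,\dots\}$, $\mathcal N=\{(a,b)\in\mathbb N_0^2:(a,b)\neq(0,0)\}$, $\mathcal G=\{(a,b)\in\mathcal N:\gcd(a,b)=1\}$ (convention $\gcd(a,0)=a$; $a/0=\infty$ for $a\in\mathbb N$). For positive irrational $\xi$: $\mathcal U(\xi)=\{(a,b)\in\mathcal N:a>b\xi\}$, $\mathcal L(\xi)=\{(a,b)\in\mathcal N:a<b\xi\}$, $\mathcal U_1(\xi)=\{(a,b)\in\mathcal U(\xi): a/b=\min\{m/n:(m,n)\in\mathcal U(\xi),\ m\le a\}\}$, $\mathcal L_2(\xi)=\{(a,b)\in\mathcal L(\xi): a/b=\max\{m/n:(m,n)\in\mathcal L(\xi),\ n\le b\}\}$; upper (resp. lower) best approximations for $\xi$ are elements of $\mathcal G\cap\mathcal U_1(\xi)$ (resp. $\mathcal G\cap\mathcal L_2(\xi)$).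 Characteristic transformation: for primes $p<q$, $\xi=\log q/\log p$, $(a,b)$ an upper or lower best approximation for $\xi$ and $\alpha=p^a/q^b$, let $(a_1,b_1),\dots,(a_N,b_N)$ be the complete list of upper or lower best approximations to $\xi$ with $a_k\le a$ and $b_k\le b$, ordered so that $b_1\le\dots\le b_N$ and $a_k\le a_{k+1}$ whenever $b_k=b_{k+1}$. Then $T_\alpha:\mathbb R^N\to\mathbb R^2$ is the linear map whose matrix has rows $(a_1,\dots,a_N)$ and $(b_1,\dots,b_N)$. -}

module Defs where

open import Data.Nat using (ℕ; zero; suc; _+_; _*_; _^_; _≤_; _<_)
open import Data.Nat.GCD using (gcd)
open import Data.Fin using (Fin; toℕ)
open import Data.Vec using (Vec; lookup; map; _∷_; []; tabulate)
open import Data.Product using (_×_; _,_; proj₁; proj₂; ∃)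
open import Data.Sum using (_⊎_)
open import Relation.Nullary using (¬_)
open import Relation.Binary.PropositionalEquality using (_≡_)

fib : ℕ → ℕ
fib zero = 0
fib (suc zero) = 1
fib (suc (suc k)) = fib (suc k) + fib k

-- Throughout, p q are the primes, ξ = log q / log p.
-- For natural a b:  a > b ξ  ⇔  a log p > b log q  ⇔  q ^ b < p ^ a,
--                   a < b ξ  ⇔  p ^ a < q ^ b.

InN : ℕ → ℕ → Set
InN a b = ¬ (a ≡ 0 × b ≡ 0)

InG : ℕ → ℕ → Set
InG a b = InN a b × gcd a b ≡ 1

InU : ℕ → ℕ → ℕ → ℕ → Set
InU p q a b = InN a b × q ^ b < p ^ a

InL : ℕ → ℕ → ℕ → ℕ → Set
InL p q a b = InN a b × p ^ a < q ^ b

-- comparison of fractions m/n ≤ a/b with x/0 = ∞ (valid on 𝒩)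
_/_≤/_/_ : ℕ → ℕ → ℕ → ℕ → Set
m / n ≤/ a / b = m * b ≤ a * n

InU1 : ℕ → ℕ → ℕ → ℕ → Set
InU1 p q a b = InU p q a b × (∀ m n → InU p q m n → m ≤ a → a / b ≤/ m / n)

InL2 : ℕ → ℕ → ℕ → ℕ → Set
InL2 p q a b = InL p q a b × (∀ m n → InL p q m n → n ≤ b → m / n ≤/ a / b)

UpperBest LowerBest BestApprox : ℕ → ℕ → ℕ → ℕ → Set
UpperBest p q a b = InG a b × InU1 p q a b
LowerBest p q a b = InG a b × InL2 p q a b
BestApprox p q a b = UpperBest p q a b ⊎ LowerBest p q a b

IsCharList : ℕ → ℕ → ℕ → ℕ → (N : ℕ) → Vec (ℕ × ℕ) N → Set
IsCharList p q a b N L =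
    (∀ x y → (BestApprox p q x y × x ≤ a × y ≤ b) → ∃ λ i → lookup L i ≡ (x , y))
  × (∀ i → BestApprox p q (proj₁ (lookup L i)) (proj₂ (lookup L i))
         × proj₁ (lookup L i) ≤ a × proj₂ (lookup L i) ≤ b)
  × (∀ i j → lookup L i ≡ lookup L j → i ≡ j)
  × (∀ (i j : Fin N) → toℕ i < toℕ j →
       (proj₂ (lookup L i) < proj₂ (lookup L j))
       ⊎ (proj₂ (lookup L i) ≡ proj₂ (lookup L j) × proj₁ (lookup L i) ≤ proj₁ (lookup L j)))

CharTransformation : ℕ → ℕ → ℕ → ℕ → (N : ℕ) → Vec (Vec ℕ N) 2 → Set
CharTransformation p q a b N T =
  BestApprox p q a b ×
  ∃ λ (L : Vec (ℕ × ℕ) N) → IsCharList p q a b N L × T ≡ (map proj₁ L ∷ map proj₂ L ∷ [])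

fibMatrix : (n : ℕ) → Vec (Vec ℕ (suc n)) 2
fibMatrix n = tabulate (λ i → fib (suc (toℕ i))) ∷ tabulate (λ i → fib (toℕ i)) ∷ []

-- (ii) By Cassini's identity the consecutive ratios h_{k+1}/h_k are Farey neighbours, and the
-- two hypotheses place ξ = log q / log p between h_n/h_{n-1} and h_{n+1}/h_n, so the ratios
-- with k ≤ n alternate around ξ (even k above, odd k below). Two neighbours straddling ξ are
-- an upper and a lower best approximation, and a fraction strictly between two neighbours has
-- numerator and denominator at least those of their mediant. Hence the best approximations
-- (x, y) with x ≤ h_{n+1}, y ≤ h_n are exactly the n + 1 pairs (h_{k+1}, h_k), in that order.
--
-- (i) With a, b, c = h_{n-1}, h_n, h_{n+1} we have c a = b² + 1 and need p ^ b < q ^ a and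
-- q ^ b < p ^ c. Take a prime p > 2 ^ (s a b) for a suitable s, let m be the integer a-th root
-- of p ^ b and take a prime q with m < q ≤ 2 ^ s m: then p ^ b < (m + 1) ^ a ≤ q ^ a, and
-- (2 ^ s m) ^ (a b) ≤ 2 ^ (s a b) p ^ (b²) < p ^ (c a). Both primes come from a Chebyshev-type
-- estimate: if (2m) ^ M < 2 ^ m there is a prime in (M, 2m], since the central binomial
-- coefficient C(2m, m) is at least 2 ^ m, while by Legendre's formula each prime power dividing
-- it is at most 2m.

module Submission where

open import Data.Nat
open import Data.Nat.Properties
open import Data.Nat.Tactic.RingSolver using (solve)
open import Data.Nat.Divisibility
open import Data.Nat.Coprimality using (Coprime; coprime-divisor; gcd≡1⇒coprime; coprime⇒gcd≡1)
import Data.Nat.Coprimality as Coprime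
open import Data.Nat.Primality using (Prime; prime?; euclidsLemma; prime⇒nonZero; prime⇒nonTrivial; ¬prime[1])
open import Data.Nat.Primality.Factorisation using (factorise)
open import Data.Nat.Combinatorics using (k![n∸k]!∣n!)
open import Data.Nat.Induction using (<-wellFounded)
open import Data.Nat.ListAction using (product)
open import Data.List using (_∷_; [])
import Data.List.Relation.Unary.All as All
open import Data.Vec using (Vec; lookup; tabulate)
import Data.Vec as Vec
open import Data.Vec.Properties using (lookup∘tabulate; tabulate-∘)
open import Data.Fin using (toℕ; fromℕ<)
open import Data.Fin.Properties using (toℕ-fromℕ<; toℕ-injective; toℕ<n)
open import Data.Product using (_×_; _,_; proj₁; proj₂; ∃; ∃-syntax; ∃₂)
open import Data.Sum using (_⊎_; inj₁; inj₂)
open import Data.Empty using (⊥-elim)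
open import Function using (_∘_; it)
open import Induction.WellFounded using (Acc; acc)
open import Relation.Nullary using (Dec; yes; no; ¬_)
open import Relation.Nullary.Decidable using (_×-dec_; from-yes)
open import Relation.Binary.Definitions using (tri<; tri≈; tri>)
open import Relation.Binary.PropositionalEquality
open import Algebra.Properties.CommutativeSemigroup +-commutativeSemigroup
  using () renaming (interchange to +-interchange)
open import Algebra.Properties.CommutativeSemigroup *-commutativeSemigroup
  using () renaming (interchange to *-interchange)
open import Defs

^-cancelˡ-< : ∀ {a b} k → a ^ k < b ^ k → a < b
^-cancelˡ-< k aᵏ<bᵏ = ≰⇒> λ b≤a → <⇒≱ aᵏ<bᵏ (^-monoˡ-≤ k b≤a)

^-cancelˡ-≤ : ∀ {a b} k .{{_ : NonZero k}} → a ^ k ≤ b ^ k → a ≤ b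
^-cancelˡ-≤ k aᵏ≤bᵏ = ≮⇒≥ λ b<a → <⇒≱ (^-monoˡ-< k b<a) aᵏ≤bᵏ

^-cancelʳ-≤ : ∀ m {a b} → 1 < m → m ^ a ≤ m ^ b → a ≤ b
^-cancelʳ-≤ m 1<m mᵃ≤mᵇ = ≮⇒≥ λ b<a → <⇒≱ (^-monoʳ-< m 1<m b<a) mᵃ≤mᵇ

^-distribʳ-* : ∀ x y n → (x * y) ^ n ≡ x ^ n * y ^ n
^-distribʳ-* x y zero = refl
^-distribʳ-* x y (suc n) = trans (cong (x * y *_) (^-distribʳ-* x y n)) (*-interchange x y (x ^ n) (y ^ n))

1<m^[1+n] : ∀ {m} n → 1 < m → 1 < m ^ suc n
1<m^[1+n] {m} n 1<m = <-≤-trans 1<m (m≤m*n m (m ^ n) {{m^n≢0 m n {{>-nonZero (<-trans z<s 1<m)}}}})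

n<m^n : ∀ {m} n → 1 < m → n < m ^ n
n<m^n zero _ = z<s
n<m^n {m} (suc n) 1<m = begin-strict
  suc n      ≤⟨ n<m^n n 1<m ⟩
  m ^ n      <⟨ m<m*n (m ^ n) m {{m^n≢0 m n {{m≢0}}}} 1<m ⟩
  m ^ n * m  ≡⟨ *-comm (m ^ n) m ⟩
  m ^ suc n  ∎
  where
  open ≤-Reasoning
  m≢0 = >-nonZero (<-trans z<s 1<m)

^-monoʳ-∣ : ∀ m {i j} → i ≤ j → m ^ i ∣ m ^ j
^-monoʳ-∣ m {i} {j} i≤j = divides (m ^ (j ∸ i)) (begin
  m ^ j                ≡⟨ cong (m ^_) (m+[n∸m]≡n i≤j) ⟨
  m ^ (i + (j ∸ i))    ≡⟨ ^-distribˡ-+-* m i (j ∸ i) ⟩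
  m ^ i * m ^ (j ∸ i)  ≡⟨ *-comm (m ^ i) (m ^ (j ∸ i)) ⟩
  m ^ (j ∸ i) * m ^ i  ∎)
  where open ≡-Reasoning

^-cross-< : ∀ a b {r s x y} .{{_ : NonZero a}} .{{_ : NonZero y}} →
            b ^ s < a ^ r → r * y ≤ x * s → b ^ y < a ^ x
^-cross-< a b {r} {s} {x} {y} bˢ<aʳ ry≤xs = ^-cancelˡ-< s (begin-strict
  (b ^ y) ^ s  ≡⟨ ^-*-assoc b y s ⟩
  b ^ (y * s)  ≡⟨ cong (b ^_) (*-comm y s) ⟩
  b ^ (s * y)  ≡⟨ ^-*-assoc b s y ⟨
  (b ^ s) ^ y  <⟨ ^-monoˡ-< y bˢ<aʳ ⟩
  (a ^ r) ^ y  ≡⟨ ^-*-assoc a r y ⟩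
  a ^ (r * y)  ≤⟨ ^-monoʳ-≤ a ry≤xs ⟩
  a ^ (x * s)  ≡⟨ ^-*-assoc a x s ⟨
  (a ^ x) ^ s  ∎)
  where open ≤-Reasoning

bracket : (f : ℕ → ℕ) (N : ℕ) {x : ℕ} → f 0 ≤ x → x < f (suc N) →
          ∃[ t ] t ≤ N × f t ≤ x × x < f (suc t)
bracket f zero f0≤x x<f1 = 0 , z≤n , f0≤x , x<f1
bracket f (suc N) {x} f0≤x x<f[2+N] with f (suc N) ≤? x
... | yes f[1+N]≤x = suc N , ≤-refl , f[1+N]≤x , x<f[2+N]
... | no f[1+N]≰x with bracket f N f0≤x (≰⇒> f[1+N]≰x)
...   | t , t≤N , bracketed = t , m≤n⇒m≤1+n t≤N , bracketed

downwardInduction : ∀ {ℓ} (P : ℕ → Set ℓ) {N : ℕ} → P N →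
                    (∀ {t} → t < N → P (suc t) → P t) → ∀ {t} → t ≤ N → P t
downwardInduction P {zero} base step z≤n = base
downwardInduction P {suc N} base step t≤1+N with m≤n⇒m<n∨m≡n t≤1+N
... | inj₂ refl = base
... | inj₁ t<1+N =
  downwardInduction P (step (n<1+n N) base) (λ t<N → step (m<n⇒m<1+n t<N)) (≤-pred t<1+N)

integer-root : ∀ a .{{_ : NonZero a}} X → 0 < X → ∃[ m ] 0 < m × m ^ a ≤ X × X < suc m ^ a
integer-root a@(suc a′) X 0<X
  with t , _ , [1+t]ᵃ≤X , X<[2+t]ᵃ ← bracket (λ t → suc t ^ a) X (subst (_≤ X) (sym (^-zeroˡ a)) 0<X)
               (≤-trans (n≤1+n (suc X)) (m≤m*n (suc (suc X)) (suc (suc X) ^ a′) {{m^n≢0 (suc (suc X)) a′}}))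
  = suc t , z<s , [1+t]ᵃ≤X , X<[2+t]ᵃ

-- Farey neighbours

record Neighbours (r s r′ s′ : ℕ) : Set where
  constructor neighbours
  field det : r′ * s ≡ r * s′ + 1

between-neighbours⇒mediant≤ : ∀ {r s r′ s′} → Neighbours r s r′ s′ → ∀ x y →
                r * y < x * s → x * s′ < r′ * y → s + s′ ≤ y × r + r′ ≤ x
between-neighbours⇒mediant≤ {r} {s} {r′} {s′} (neighbours det) x y ry<xs xs′<r′y
  with B , xs≡ry+B ← m≤n⇒∃[o]m+o≡n ry<xs | A , r′y≡xs′+A ← m≤n⇒∃[o]m+o≡n xs′<r′y =
  subst (s + s′ ≤_) (sym y≡sA+s′B) (+-mono-≤ (m≤m*n s (suc A)) (m≤m*n s′ (suc B))) ,
  subst (r + r′ ≤_) (sym x≡rA+r′B) (+-mono-≤ (m≤m*n r (suc A)) (m≤m*n r′ (suc B)))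
  where
  -- Since r′ s − r s′ = 1: y = s (r′ y − x s′) + s′ (x s − r y) and x = r (r′ y − x s′) + r′ (x s − r y).
  open ≡-Reasoning
  y≡sA+s′B : y ≡ s * (1 + A) + s′ * (1 + B)
  y≡sA+s′B = +-cancelˡ-≡ (r * s′ * y) _ _ (begin
    r * s′ * y + y                         ≡⟨ solve (r ∷ s′ ∷ y ∷ []) ⟩
    (r * s′ + 1) * y                       ≡⟨ cong (_* y) det ⟨
    r′ * s * y                             ≡⟨ solve (r′ ∷ s ∷ y ∷ []) ⟩
    s * (r′ * y)                           ≡⟨ cong (s *_) r′y≡xs′+A ⟨
    s * (1 + x * s′ + A)                   ≡⟨ solve (s ∷ x ∷ s′ ∷ A ∷ []) ⟩
    s′ * (x * s) + s * (1 + A)             ≡⟨ cong (λ z → s′ * z + s * (1 + A)) xs≡ry+B ⟨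
    s′ * (1 + r * y + B) + s * (1 + A)     ≡⟨ solve (s′ ∷ r ∷ y ∷ B ∷ s ∷ A ∷ []) ⟩
    r * s′ * y + (s * (1 + A) + s′ * (1 + B)) ∎)
  x≡rA+r′B : x ≡ r * (1 + A) + r′ * (1 + B)
  x≡rA+r′B = +-cancelˡ-≡ (r * s′ * x) _ _ (begin
    r * s′ * x + x                         ≡⟨ solve (r ∷ s′ ∷ x ∷ []) ⟩
    (r * s′ + 1) * x                       ≡⟨ cong (_* x) det ⟨
    r′ * s * x                             ≡⟨ solve (r′ ∷ s ∷ x ∷ []) ⟩
    r′ * (x * s)                           ≡⟨ cong (r′ *_) xs≡ry+B ⟨
    r′ * (1 + r * y + B)                   ≡⟨ solve (r′ ∷ r ∷ y ∷ B ∷ []) ⟩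
    r * (r′ * y) + r′ * (1 + B)            ≡⟨ cong (λ z → r * z + r′ * (1 + B)) r′y≡xs′+A ⟨
    r * (1 + x * s′ + A) + r′ * (1 + B)    ≡⟨ solve (r ∷ x ∷ s′ ∷ A ∷ r′ ∷ B ∷ []) ⟩
    r * s′ * x + (r * (1 + A) + r′ * (1 + B)) ∎)

mediant-below : ∀ {r s r′ s′} → Neighbours r s r′ s′ → (r + r′) * s′ ≤ r′ * (s + s′)
mediant-below {r} {s} {r′} {s′} (neighbours det) = begin
  (r + r′) * s′      ≡⟨ *-distribʳ-+ s′ r r′ ⟩
  r * s′ + r′ * s′   ≤⟨ +-monoˡ-≤ (r′ * s′) (subst (r * s′ ≤_) (sym det) (m≤m+n (r * s′) 1)) ⟩
  r′ * s + r′ * s′   ≡⟨ *-distribˡ-+ r′ s s′ ⟨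
  r′ * (s + s′)      ∎
  where open ≤-Reasoning

mediant-above : ∀ {r s r′ s′} → Neighbours r s r′ s′ → r * (s′ + s) ≤ (r′ + r) * s
mediant-above {r} {s} {r′} {s′} (neighbours det) = begin
  r * (s′ + s)       ≡⟨ *-distribˡ-+ r s′ s ⟩
  r * s′ + r * s     ≤⟨ +-monoˡ-≤ (r * s) (subst (r * s′ ≤_) (sym det) (m≤m+n (r * s′) 1)) ⟩
  r′ * s + r * s     ≡⟨ *-distribʳ-+ s r′ r ⟨
  (r′ + r) * s       ∎
  where open ≤-Reasoning

neighbours⇒coprimeˡ : ∀ {r s r′ s′} → Neighbours r s r′ s′ → Coprime r s
neighbours⇒coprimeˡ {r} {s} {r′} {s′} (neighbours det) {d} (d∣r , d∣s) =
  ∣1⇒≡1 (∣m+n∣m⇒∣n (subst (d ∣_) det (∣n⇒∣m*n r′ d∣s)) (∣m⇒∣m*n s′ d∣r))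

neighbours⇒coprimeʳ : ∀ {r s r′ s′} → Neighbours r s r′ s′ → Coprime r′ s′
neighbours⇒coprimeʳ {r} {s} {r′} {s′} (neighbours det) {d} (d∣r′ , d∣s′) =
  ∣1⇒≡1 (∣m+n∣m⇒∣n (subst (d ∣_) det (∣m⇒∣m*n s d∣r′)) (∣n⇒∣m*n r d∣s′))

coprime-cross⇒≡ : ∀ {x y r s} → Coprime x y → Coprime r s → x * s ≡ r * y → x ≡ r × y ≡ s
coprime-cross⇒≡ {x} {y} {r} {s} x⊥y r⊥s xs≡ry =
  ∣-antisym (coprime-divisor x⊥y (divides s (trans (*-comm y r) (trans (sym xs≡ry) (*-comm x s)))))
            (coprime-divisor r⊥s (divides y (trans (*-comm s x) (trans xs≡ry (*-comm r y))))) ,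
  ∣-antisym (coprime-divisor (Coprime.sym x⊥y) (divides r xs≡ry))
            (coprime-divisor (Coprime.sym r⊥s) (divides x (sym xs≡ry)))

-- Best approximations to ξ = log q / log p

module Approximation (p q : ℕ) (1<p : 1 < p) (1<q : 1 < q) where

  private instance
    p≢0 : NonZero p
    p≢0 = >-nonZero (<-trans z<s 1<p)

  InU-upward : ∀ {x y r s} → InN x y → InU p q r s → r * y ≤ x * s → InU p q x y
  InU-upward {zero}  {zero}   𝒩 _ _ = ⊥-elim (𝒩 (refl , refl))
  InU-upward {suc x} {zero}   𝒩 _ _ = 𝒩 , 1<m^[1+n] x 1<p
  InU-upward {x} {suc y} {r} {s} 𝒩 (_ , qˢ<pʳ) ry≤xs =
    𝒩 , ^-cross-< p q {r} {s} {x} {suc y} qˢ<pʳ ry≤xs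

  InL-downward : ∀ {x y r s} → InN x y → InL p q r s → x * s ≤ r * y → InL p q x y
  InL-downward {zero} {zero}  𝒩 _ _ = ⊥-elim (𝒩 (refl , refl))
  InL-downward {zero} {suc y} 𝒩 _ _ = 𝒩 , 1<m^[1+n] y 1<q
  InL-downward {suc x} {y} {r} {s} 𝒩 (_ , pʳ<qˢ) xs≤ry =
    𝒩 , ^-cross-< q p {s} {r} {y} {suc x} {{q≢0}} pʳ<qˢ (subst₂ _≤_ (*-comm (suc x) s) (*-comm r y) xs≤ry)
    where q≢0 = >-nonZero (<-trans z<s 1<q)

  InU⇒0<numerator : ∀ {x y} → InU p q x y → 0 < x
  InU⇒0<numerator {zero} {y} (_ , qʸ<1) = ⊥-elim (<⇒≱ qʸ<1 (m^n>0 q {{>-nonZero (<-trans z<s 1<q)}} y))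
  InU⇒0<numerator {suc x} _ = z<s

  InL⇒0<denominator : ∀ {x y} → InL p q x y → 0 < y
  InL⇒0<denominator {x} {zero} (_ , pˣ<1) = ⊥-elim (<⇒≱ pˣ<1 (m^n>0 p x))
  InL⇒0<denominator {x} {suc y} _ = z<s

  InU∧InL⇒< : ∀ {x y r s} → InU p q x y → InL p q r s → r * y < x * s
  InU∧InL⇒< (𝒩 , qʸ<pˣ) ℓ = ≰⇒> λ xs≤ry → <-asym qʸ<pˣ (proj₂ (InL-downward 𝒩 ℓ xs≤ry))

  module _ {r s r′ s′} (ℓ : InL p q r s) (u : InU p q r′ s′) (nb : Neighbours r s r′ s′) where

    neighbours⇒UpperBest : 0 < r → UpperBest p q r′ s′
    neighbours⇒UpperBest 0<r = (proj₁ u , coprime⇒gcd≡1 (neighbours⇒coprimeʳ nb)) , u , optimal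
      where
      optimal : ∀ m n → InU p q m n → m ≤ r′ → r′ / s′ ≤/ m / n
      optimal m n uₘ m≤r′ = ≮⇒≥ λ ms′<r′n →
        <⇒≱ (m<n+m r′ 0<r) (≤-trans (proj₂ (between-neighbours⇒mediant≤ nb m n (InU∧InL⇒< uₘ ℓ) ms′<r′n)) m≤r′)

    neighbours⇒LowerBest : 0 < s′ → LowerBest p q r s
    neighbours⇒LowerBest 0<s′ = (proj₁ ℓ , coprime⇒gcd≡1 (neighbours⇒coprimeˡ nb)) , ℓ , optimal
      where
      optimal : ∀ m n → InL p q m n → n ≤ s → m / n ≤/ r / s
      optimal m n ℓₘ n≤s = ≮⇒≥ λ rn<ms →
        <⇒≱ (m<m+n s 0<s′) (≤-trans (proj₁ (between-neighbours⇒mediant≤ nb m n rn<ms (InU∧InL⇒< u ℓₘ))) n≤s)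

    UpperBest-between : ∀ {x y} → UpperBest p q x y → r′ ≤ x → x < r + r′ → x ≡ r′ × y ≡ s′
    UpperBest-between {x} {y} ((_ , gcd≡1) , uₓ , optimal) r′≤x x<r+r′
      with m≤n⇒m<n∨m≡n (optimal r′ s′ u r′≤x)
    ... | inj₁ xs′<r′y = ⊥-elim (<⇒≱ x<r+r′ (proj₂ (between-neighbours⇒mediant≤ nb x y (InU∧InL⇒< uₓ ℓ) xs′<r′y)))
    ... | inj₂ xs′≡r′y = coprime-cross⇒≡ (gcd≡1⇒coprime gcd≡1) (neighbours⇒coprimeʳ nb) xs′≡r′y

    LowerBest-between : ∀ {x y} → LowerBest p q x y → s ≤ y → y < s + s′ → x ≡ r × y ≡ s
    LowerBest-between {x} {y} ((_ , gcd≡1) , ℓₓ , optimal) s≤y y<s+s′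
      with m≤n⇒m<n∨m≡n (optimal r s ℓ s≤y)
    ... | inj₁ ry<xs = ⊥-elim (<⇒≱ y<s+s′ (proj₁ (between-neighbours⇒mediant≤ nb x y ry<xs (InU∧InL⇒< u ℓₓ))))
    ... | inj₂ ry≡xs = coprime-cross⇒≡ (gcd≡1⇒coprime gcd≡1) (neighbours⇒coprimeˡ nb) (sym ry≡xs)

fib-pos : ∀ k → 0 < fib (suc k)
fib-pos zero = z<s
fib-pos (suc k) = <-≤-trans (fib-pos k) (m≤m+n (fib (suc k)) (fib k))

fib-mono : ∀ {i j} → i ≤ j → fib i ≤ fib j
fib-mono {j = zero} z≤n = ≤-refl
fib-mono {i} {suc j} i≤1+j with m≤n⇒m<n∨m≡n i≤1+j
... | inj₂ refl = ≤-refl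
... | inj₁ (s≤s i≤j) = ≤-trans (fib-mono i≤j) (fib≤fib[1+] j)
  where
  fib≤fib[1+] : ∀ k → fib k ≤ fib (suc k)
  fib≤fib[1+] zero = z≤n
  fib≤fib[1+] (suc k) = m≤m+n (fib (suc k)) (fib k)

fib-< : ∀ {i j} → 2 ≤ i → i < j → fib i < fib j
fib-< {suc (suc i)} (s≤s (s≤s z≤n)) i<j = <-≤-trans (m<m+n (fib (2 + i)) (fib-pos i)) (fib-mono i<j)

-- Cassini's identity h_{k+1}² − h_k h_{k+2} = (−1) ^ k, split by the parity of k to stay in ℕ.
private
  cassini-step-odd : ∀ u v → v * v ≡ (v + u) * u + 1 → (v + u + v) * v ≡ (v + u) * (v + u) + 1
  cassini-step-odd u v vv≡ = begin
    (v + u + v) * v                  ≡⟨ solve (u ∷ v ∷ []) ⟩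
    (v + u) * v + v * v              ≡⟨ cong ((v + u) * v +_) vv≡ ⟩
    (v + u) * v + ((v + u) * u + 1)  ≡⟨ solve (u ∷ v ∷ []) ⟩
    (v + u) * (v + u) + 1            ∎
    where open ≡-Reasoning

  cassini-step-even : ∀ u v → (v + u) * u ≡ v * v + 1 → (v + u) * (v + u) ≡ (v + u + v) * v + 1
  cassini-step-even u v [v+u]u≡ = begin
    (v + u) * (v + u)          ≡⟨ solve (u ∷ v ∷ []) ⟩
    (v + u) * v + (v + u) * u  ≡⟨ cong ((v + u) * v +_) [v+u]u≡ ⟩
    (v + u) * v + (v * v + 1)  ≡⟨ solve (u ∷ v ∷ []) ⟩
    (v + u + v) * v + 1        ∎
    where open ≡-Reasoning

cassini-even : ∀ t → Neighbours (fib (2 + t * 2)) (fib (1 + t * 2)) (fib (1 + t * 2)) (fib (t * 2))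
cassini-odd  : ∀ t → Neighbours (fib (2 + t * 2)) (fib (1 + t * 2)) (fib (3 + t * 2)) (fib (2 + t * 2))
cassini-even zero = neighbours refl
cassini-even (suc t) with neighbours det ← cassini-odd t =
  neighbours (cassini-step-even (fib (1 + t * 2)) (fib (2 + t * 2)) det)
cassini-odd t with neighbours det ← cassini-even t =
  neighbours (cassini-step-odd (fib (t * 2)) (fib (1 + t * 2)) det)

convergent : ℕ → ℕ × ℕ
convergent k = fib (suc k) , fib k

convergent-InN : ∀ k → InN (fib (suc k)) (fib k)
convergent-InN k (fib[1+k]≡0 , _) = <⇒≢ (fib-pos k) (sym fib[1+k]≡0)

<⇒convergent≢ : ∀ {i j} → i < j → convergent i ≢ convergent j
<⇒convergent≢ {zero} {suc j} _ eq = <⇒≢ (fib-pos j) (cong proj₂ eq)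
<⇒convergent≢ {suc i} i<j eq = <⇒≢ (fib-< (s≤s (s≤s z≤n)) (s≤s i<j)) (cong proj₁ eq)

convergent-injective : ∀ {i j} → convergent i ≡ convergent j → i ≡ j
convergent-injective {i} {j} eq with <-cmp i j
... | tri< i<j _ _ = ⊥-elim (<⇒convergent≢ i<j eq)
... | tri≈ _ i≡j _ = i≡j
... | tri> _ _ j<i = ⊥-elim (<⇒convergent≢ j<i (sym eq))

even-or-odd : ∀ k → ∃[ t ] (k ≡ t * 2 ⊎ k ≡ 1 + t * 2)
even-or-odd zero = 0 , inj₁ refl
even-or-odd (suc k) with even-or-odd k
... | t , inj₁ refl = t , inj₂ refl
... | t , inj₂ refl = suc t , inj₁ refl

-- The best approximations up to (h_{n+1}, h_n)

module FibonacciConvergents (p q : ℕ) (1<p : 1 < p) (1<q : 1 < q) (M : ℕ)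
  (lower : InL p q (fib (2 + M * 2)) (fib (1 + M * 2)))
  (upper : InU p q (fib (3 + M * 2)) (fib (2 + M * 2))) where

  open Approximation p q 1<p 1<q

  n : ℕ
  n = suc M * 2

  even-InU : ∀ {t} → t ≤ suc M → InU p q (fib (1 + t * 2)) (fib (t * 2))
  even-InU = downwardInduction (λ t → InU p q (fib (1 + t * 2)) (fib (t * 2))) upper
    λ {t} _ u → InU-upward (convergent-InN (t * 2)) u (mediant-below (cassini-even t))

  odd-InL : ∀ {t} → t ≤ M → InL p q (fib (2 + t * 2)) (fib (1 + t * 2))
  odd-InL = downwardInduction (λ t → InL p q (fib (2 + t * 2)) (fib (1 + t * 2))) lower
    λ {t} _ ℓ → InL-downward (convergent-InN (1 + t * 2)) ℓ (mediant-above (cassini-odd t))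

  even-UpperBest : ∀ {t} → t ≤ suc M → UpperBest p q (fib (1 + t * 2)) (fib (t * 2))
  even-UpperBest {zero} _ = neighbours⇒UpperBest (odd-InL z≤n) (even-InU z≤n) (cassini-even 0) z<s
  even-UpperBest {suc t} t<1+M =
    neighbours⇒UpperBest (odd-InL (≤-pred t<1+M)) (even-InU t<1+M) (cassini-odd t) (fib-pos (1 + t * 2))

  odd-LowerBest : ∀ {t} → t ≤ M → LowerBest p q (fib (2 + t * 2)) (fib (1 + t * 2))
  odd-LowerBest {t} t≤M =
    neighbours⇒LowerBest (odd-InL t≤M) (even-InU (s≤s t≤M)) (cassini-odd t) (fib-pos (1 + t * 2))

  UpperBest⇒even : ∀ {x y} → UpperBest p q x y → x ≤ fib (suc n) → y ≤ fib n →
                   ∃[ t ] t ≤ suc M × x ≡ fib (1 + t * 2) × y ≡ fib (t * 2)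
  UpperBest⇒even {x} {y} ub@(_ , u , optimal) x≤ y≤
    with bracket (λ t → fib (1 + t * 2)) (suc M) (InU⇒0<numerator u)
                 (≤-<-trans x≤ (m<n+m (fib (suc n)) (fib-pos (suc n))))
  ... | t , t≤1+M , fib≤x , x<fib with m≤n⇒m<n∨m≡n t≤1+M
  ...   | inj₁ (s≤s t≤M) =
          t , t≤1+M , UpperBest-between (odd-InL t≤M) (even-InU t≤1+M) (cassini-even t) ub fib≤x x<fib
  ...   | inj₂ refl = suc M , ≤-refl , x≡ , ≤-antisym y≤ fib≤y
    where
    x≡ : x ≡ fib (suc n)
    x≡ = ≤-antisym x≤ fib≤x
    fib≤y : fib n ≤ y
    fib≤y = *-cancelˡ-≤ (fib (suc n)) {{>-nonZero (fib-pos n)}}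
              (subst (λ z → z * fib n ≤ fib (suc n) * y) x≡ (optimal (fib (suc n)) (fib n) upper fib≤x))

  LowerBest⇒odd : ∀ {x y} → LowerBest p q x y → y ≤ fib n →
                  ∃[ t ] t ≤ M × x ≡ fib (2 + t * 2) × y ≡ fib (1 + t * 2)
  LowerBest⇒odd {x} {y} lb@(_ , ℓ , _) y≤
    with bracket (λ t → fib (1 + t * 2)) M (InL⇒0<denominator ℓ)
                 (≤-<-trans y≤ (m<m+n (fib n) (fib-pos (M * 2))))
  ... | t , t≤M , fib≤y , y<fib =
    t , t≤M , LowerBest-between (odd-InL t≤M) (even-InU (s≤s t≤M)) (cassini-odd t) lb fib≤y
                (subst (y <_) (+-comm (fib (2 + t * 2)) (fib (1 + t * 2))) y<fib)

  convergent-BestApprox : ∀ {k} → k ≤ n → BestApprox p q (fib (suc k)) (fib k)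
  convergent-BestApprox {k} k≤n with even-or-odd k
  ... | t , inj₁ refl = inj₁ (even-UpperBest (*-cancelʳ-≤ t (suc M) 2 k≤n))
  ... | t , inj₂ refl = inj₂ (odd-LowerBest (≤-pred (*-cancelʳ-< 2 t (suc M) k≤n)))

  BestApprox⇒convergent : ∀ {x y} → BestApprox p q x y → x ≤ fib (suc n) → y ≤ fib n →
                          ∃[ k ] k ≤ n × convergent k ≡ (x , y)
  BestApprox⇒convergent (inj₁ ub) x≤ y≤ with UpperBest⇒even ub x≤ y≤
  ... | t , t≤1+M , refl , refl = t * 2 , *-monoˡ-≤ 2 t≤1+M , refl
  BestApprox⇒convergent (inj₂ lb) x≤ y≤ with LowerBest⇒odd lb y≤
  ... | t , t≤M , refl , refl = 1 + t * 2 , s≤s (m≤n⇒m≤1+n (*-monoˡ-≤ 2 t≤M)) , refl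

  convergents : Vec (ℕ × ℕ) (suc n)
  convergents = tabulate (convergent ∘ toℕ)

  lookup-convergents : ∀ i → lookup convergents i ≡ convergent (toℕ i)
  lookup-convergents = lookup∘tabulate (convergent ∘ toℕ)

  convergents-isCharList : IsCharList p q (fib (suc n)) (fib n) (suc n) convergents
  convergents-isCharList = complete , sound , injective , ordered
    where
    complete : ∀ x y → BestApprox p q x y × x ≤ fib (suc n) × y ≤ fib n →
               ∃ λ i → lookup convergents i ≡ (x , y)
    complete x y (ba , x≤ , y≤) with k , k≤n , eq ← BestApprox⇒convergent ba x≤ y≤ =
      fromℕ< k<1+n , trans (lookup-convergents (fromℕ< k<1+n)) (trans (cong convergent (toℕ-fromℕ< k<1+n)) eq)
      where k<1+n = s≤s k≤n

    sound : ∀ i → BestApprox p q (proj₁ (lookup convergents i)) (proj₂ (lookup convergents i))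
                  × proj₁ (lookup convergents i) ≤ fib (suc n) × proj₂ (lookup convergents i) ≤ fib n
    sound i rewrite lookup-convergents i =
      convergent-BestApprox i≤n , fib-mono (s≤s i≤n) , fib-mono i≤n
      where i≤n = ≤-pred (toℕ<n i)

    injective : ∀ i j → lookup convergents i ≡ lookup convergents j → i ≡ j
    injective i j eq rewrite lookup-convergents i | lookup-convergents j =
      toℕ-injective (convergent-injective eq)

    ordered : ∀ i j → toℕ i < toℕ j →
              proj₂ (lookup convergents i) < proj₂ (lookup convergents j)
              ⊎ (proj₂ (lookup convergents i) ≡ proj₂ (lookup convergents j)
                 × proj₁ (lookup convergents i) ≤ proj₁ (lookup convergents j))
    ordered i j i<j rewrite lookup-convergents i | lookup-convergents j
      with m≤n⇒m<n∨m≡n (fib-mono (<⇒≤ i<j))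
    ... | inj₁ fib<fib = inj₁ fib<fib
    ... | inj₂ fib≡fib = inj₂ (fib≡fib , fib-mono (s≤s (<⇒≤ i<j)))

  charTransformation : CharTransformation p q (fib (suc n)) (fib n) (suc n) (fibMatrix n)
  charTransformation =
    inj₁ (even-UpperBest ≤-refl) , convergents , convergents-isCharList ,
    cong₂ (λ as bs → as Vec.∷ bs Vec.∷ Vec.[]) (tabulate-∘ proj₁ (convergent ∘ toℕ)) (tabulate-∘ proj₂ (convergent ∘ toℕ))

-- Legendre's formula

prime⇒1< : ∀ {p} → Prime p → 1 < p
prime⇒1< {p} pr = nonTrivial⇒n>1 p {{prime⇒nonTrivial pr}}

prime∤1 : ∀ {p} → Prime p → ¬ p ∣ 1
prime∤1 pr p∣1 = ¬prime[1] (subst Prime (∣1⇒≡1 p∣1) pr)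

prime∤* : ∀ {p m n} → Prime p → ¬ p ∣ m → ¬ p ∣ n → ¬ p ∣ m * n
prime∤* {m = m} {n} pr p∤m p∤n p∣mn with euclidsLemma m n pr p∣mn
... | inj₁ p∣m = p∤m p∣m
... | inj₂ p∣n = p∤n p∣n

factor-out : ∀ p .{{_ : NonTrivial p}} n .{{_ : NonZero n}} → ∃[ e ] ∃[ r ] n ≡ p ^ e * r × ¬ p ∣ r
factor-out p n = go n (<-wellFounded n)
  where
  go : ∀ n .{{_ : NonZero n}} → Acc _<_ n → ∃[ e ] ∃[ r ] n ≡ p ^ e * r × ¬ p ∣ r
  go n (acc rec) with p ∣? n
  ... | no p∤n = 0 , n , sym (+-identityʳ n) , p∤n
  ... | yes p∣n with e , r , eq , p∤r ← go (quotient p∣n) {{quotient≢0 p∣n}} (rec (quotient-< p∣n)) =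
    suc e , r , trans (m∣n⇒n≡m*quotient p∣n) (trans (cong (p *_) eq) (sym (*-assoc p (p ^ e) r))) , p∤r

p^k∣p^e*r⇒k≤e : ∀ {p r} .{{_ : NonZero p}} → ¬ p ∣ r → ∀ k e → p ^ k ∣ p ^ e * r → k ≤ e
p^k∣p^e*r⇒k≤e p∤r zero e _ = z≤n
p^k∣p^e*r⇒k≤e {p} {r} p∤r (suc k) zero pᵏ⁺¹∣r =
  ⊥-elim (p∤r (∣-trans (m∣m*n (p ^ k)) (subst (p ^ suc k ∣_) (*-identityˡ r) pᵏ⁺¹∣r)))
p^k∣p^e*r⇒k≤e {p} {r} p∤r (suc k) (suc e) pᵏ⁺¹∣pᵉ⁺¹r = s≤s (p^k∣p^e*r⇒k≤e p∤r k e
  (*-cancelˡ-∣ p (subst (p * p ^ k ∣_) (*-assoc p (p ^ e) r) pᵏ⁺¹∣pᵉ⁺¹r)))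

indicator : ∀ {A : Set} → Dec A → ℕ
indicator (yes _) = 1
indicator (no _) = 0

indicator-cong : ∀ {A B : Set} (a? : Dec A) (b? : Dec B) → (A → B) → (B → A) → indicator a? ≡ indicator b?
indicator-cong (yes _) (yes _) _ _ = refl
indicator-cong (no _)  (no _)  _ _ = refl
indicator-cong (yes a) (no ¬b) f _ = ⊥-elim (¬b (f a))
indicator-cong (no ¬a) (yes b) _ g = ⊥-elim (¬a (g b))

sumTo : ℕ → (ℕ → ℕ) → ℕ
sumTo zero f = 0
sumTo (suc K) f = f (suc K) + sumTo K f

sumTo-cong : ∀ K {f g} → (∀ i → f i ≡ g i) → sumTo K f ≡ sumTo K g
sumTo-cong zero _ = refl
sumTo-cong (suc K) f≗g = cong₂ _+_ (f≗g (suc K)) (sumTo-cong K f≗g)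

sumTo-mono-≤ : ∀ K {f g} → (∀ i → f i ≤ g i) → sumTo K f ≤ sumTo K g
sumTo-mono-≤ zero _ = z≤n
sumTo-mono-≤ (suc K) f≤g = +-mono-≤ (f≤g (suc K)) (sumTo-mono-≤ K f≤g)

sumTo-+ : ∀ K f g → sumTo K (λ i → f i + g i) ≡ sumTo K f + sumTo K g
sumTo-+ zero f g = refl
sumTo-+ (suc K) f g = trans (cong (f (suc K) + g (suc K) +_) (sumTo-+ K f g))
                            (+-interchange (f (suc K)) (g (suc K)) (sumTo K f) (sumTo K g))

sumTo-zero : ∀ K → sumTo K (λ _ → 0) ≡ 0
sumTo-zero zero = refl
sumTo-zero (suc K) = sumTo-zero K

sumTo-indicator≤ : ∀ {P : ℕ → Set} K (P? : ∀ i → Dec (P i)) → sumTo K (λ i → indicator (P? i)) ≤ K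
sumTo-indicator≤ zero P? = z≤n
sumTo-indicator≤ (suc K) P? with P? (suc K)
... | yes _ = s≤s (sumTo-indicator≤ K P?)
... | no _ = m≤n⇒m≤1+n (sumTo-indicator≤ K P?)

sumTo-indicator[≤?]≡⊓ : ∀ K v → sumTo K (λ i → indicator (i ≤? v)) ≡ K ⊓ v
sumTo-indicator[≤?]≡⊓ zero v = refl
sumTo-indicator[≤?]≡⊓ (suc K) v with suc K ≤? v
... | yes 1+K≤v = begin
  suc (sumTo K (λ i → indicator (i ≤? v))) ≡⟨ cong suc (sumTo-indicator[≤?]≡⊓ K v) ⟩
  suc (K ⊓ v)                              ≡⟨ cong suc (m≤n⇒m⊓n≡m (<⇒≤ 1+K≤v)) ⟩
  suc K                                    ≡⟨ m≤n⇒m⊓n≡m 1+K≤v ⟨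
  suc K ⊓ v                                ∎
  where open ≡-Reasoning
... | no 1+K≰v = begin
  sumTo K (λ i → indicator (i ≤? v)) ≡⟨ sumTo-indicator[≤?]≡⊓ K v ⟩
  K ⊓ v                              ≡⟨ m≥n⇒m⊓n≡n v≤K ⟩
  v                                  ≡⟨ m≥n⇒m⊓n≡n (m≤n⇒m≤1+n v≤K) ⟨
  suc K ⊓ v                          ∎
  where
  open ≡-Reasoning
  v≤K = ≤-pred (≰⇒> 1+K≰v)

^-powers-below≤ : ∀ r .{{_ : NonZero r}} B K → 0 < B → r ^ sumTo K (λ i → indicator (r ^ i ≤? B)) ≤ B
^-powers-below≤ r B zero 0<B = 0<B
^-powers-below≤ r B (suc K) 0<B with r ^ suc K ≤? B
... | yes rᴷ⁺¹≤B = ≤-trans (^-monoʳ-≤ r (s≤s (sumTo-indicator≤ K (λ i → r ^ i ≤? B)))) rᴷ⁺¹≤B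
... | no _ = ^-powers-below≤ r B K 0<B

-- multiples d n = ⌊ n / d ⌋
multiples : ℕ → ℕ → ℕ
multiples d zero = 0
multiples d (suc n) = indicator (d ∣? suc n) + multiples d n

multiples-bounds : ∀ d .{{_ : NonZero d}} n → multiples d n * d ≤ n × n < suc (multiples d n) * d
multiples-bounds d zero = z≤n , subst (0 <_) (sym (+-identityʳ d)) (>-nonZero⁻¹ d)
multiples-bounds d (suc n) with multiples-bounds d n | d ∣? suc n
... | lower , upper | yes (divides e 1+n≡ed) =
  ≤-reflexive (sym 1+n≡[1+c]d) ,
  subst (suc n <_) (trans (+-comm (suc n) d) (cong (d +_) 1+n≡[1+c]d)) (m<m+n (suc n) (>-nonZero⁻¹ d))
  where
  c = multiples d n
  c<e : c < e
  c<e = *-cancelʳ-< d c e (subst (c * d <_) 1+n≡ed (s≤s lower))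
  1+n≡[1+c]d : suc n ≡ suc c * d
  1+n≡[1+c]d = ≤-antisym upper (subst (suc c * d ≤_) (sym 1+n≡ed) (*-monoˡ-≤ d c<e))
... | lower , upper | no d∤1+n =
  m≤n⇒m≤1+n lower , ≤∧≢⇒< upper λ 1+n≡[1+c]d → d∤1+n (divides (suc (multiples d n)) 1+n≡[1+c]d)

multiples-double : ∀ d .{{_ : NonZero d}} m →
  multiples d (m + m) ≤ indicator (d ≤? m + m) + (multiples d m + multiples d m)
multiples-double d m with multiples-bounds d m | multiples-bounds d (m + m) | d ≤? m + m
... | _ , m<[1+c]d | C*d≤2m , _ | yes _ = ≤-pred (*-cancelʳ-< d _ _ (begin-strict
  multiples d (m + m) * d   ≤⟨ C*d≤2m ⟩
  m + m                     <⟨ +-mono-< m<[1+c]d m<[1+c]d ⟩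
  suc c * d + suc c * d     ≡⟨ *-distribʳ-+ d (suc c) (suc c) ⟨
  (suc c + suc c) * d       ≡⟨ cong (λ z → suc z * d) (+-suc c c) ⟩
  suc (suc (c + c)) * d     ∎))
  where
  open ≤-Reasoning
  c = multiples d m
... | _ , _ | C*d≤2m , _ | no d≰2m = subst (_≤ 0 + (multiples d m + multiples d m)) (sym C≡0) z≤n
  where
  C≡0 : multiples d (m + m) ≡ 0
  C≡0 = n<1⇒n≡0 (*-cancelʳ-< d _ 1 (≤-<-trans C*d≤2m (subst (m + m <_) (sym (+-identityʳ d)) (≰⇒> d≰2m))))

legendreSum : ℕ → ℕ → ℕ → ℕ
legendreSum p K n = sumTo K (λ i → multiples (p ^ i) n)

legendre : ∀ {p} → Prime p → ∀ K n → n ≤ p ^ K → ∃[ u ] n ! ≡ p ^ legendreSum p K n * u × ¬ p ∣ u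
legendre {p} pr K zero _ = 1 , cong (λ e → p ^ e * 1) (sym (sumTo-zero K)) , prime∤1 pr
legendre {p} pr K (suc n) 1+n≤pᴷ
  with u , n!≡ , p∤u ← legendre pr K n (≤-trans (n≤1+n n) 1+n≤pᴷ)
     | v , s , 1+n≡pᵛs , p∤s ← factor-out p {{prime⇒nonTrivial pr}} (suc n)
  = s * u , 1+n!≡ , prime∤* pr p∤s p∤u
  where
  instance
    p≢0 : NonZero p
    p≢0 = prime⇒nonZero pr
  S = legendreSum p K n
  s≢0 : NonZero s
  s≢0 = m*n≢0⇒n≢0 (p ^ v) {{subst NonZero 1+n≡pᵛs _}}
  v≤K : v ≤ K
  v≤K = ^-cancelʳ-≤ p (prime⇒1< pr) (≤-trans (subst (p ^ v ≤_) (sym 1+n≡pᵛs) (m≤m*n (p ^ v) s {{s≢0}})) 1+n≤pᴷ)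
  pⁱ∣1+n⇔i≤v : ∀ i → indicator (p ^ i ∣? suc n) ≡ indicator (i ≤? v)
  pⁱ∣1+n⇔i≤v i = indicator-cong (p ^ i ∣? suc n) (i ≤? v)
    (λ pⁱ∣1+n → p^k∣p^e*r⇒k≤e p∤s i v (subst (p ^ i ∣_) 1+n≡pᵛs pⁱ∣1+n))
    (λ i≤v → subst (p ^ i ∣_) (sym 1+n≡pᵛs) (∣-trans (^-monoʳ-∣ p i≤v) (m∣m*n s)))
  legendreSum-suc : legendreSum p K (suc n) ≡ v + S
  legendreSum-suc = begin
    legendreSum p K (suc n)                            ≡⟨ sumTo-+ K (λ i → indicator (p ^ i ∣? suc n)) _ ⟩
    sumTo K (λ i → indicator (p ^ i ∣? suc n)) + S     ≡⟨ cong (_+ S) (sumTo-cong K pⁱ∣1+n⇔i≤v) ⟩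
    sumTo K (λ i → indicator (i ≤? v)) + S             ≡⟨ cong (_+ S) (sumTo-indicator[≤?]≡⊓ K v) ⟩
    K ⊓ v + S                                          ≡⟨ cong (_+ S) (m≥n⇒m⊓n≡n v≤K) ⟩
    v + S                                              ∎
    where open ≡-Reasoning
  1+n!≡ : suc n ! ≡ p ^ legendreSum p K (suc n) * (s * u)
  1+n!≡ = begin
    suc n * n !                    ≡⟨ cong₂ _*_ 1+n≡pᵛs n!≡ ⟩
    (p ^ v * s) * (p ^ S * u)      ≡⟨ *-interchange (p ^ v) s (p ^ S) u ⟩
    (p ^ v * p ^ S) * (s * u)      ≡⟨ cong (_* (s * u)) (^-distribˡ-+-* p v S) ⟨
    p ^ (v + S) * (s * u)          ≡⟨ cong (λ e → p ^ e * (s * u)) legendreSum-suc ⟨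
    p ^ legendreSum p K (suc n) * (s * u) ∎
    where open ≡-Reasoning

-- Primes in ranges

centralBinomial : ∀ m → ∃[ C ] (m + m) ! ≡ C * (m ! * m !)
centralBinomial m with divides C eq ← k![n∸k]!∣n! {m + m} {m} (m≤m+n m m) =
  C , trans eq (cong (λ k → C * (m ! * k !)) (m+n∸m≡n m m))

2^m*m!*m!≤[m+m]! : ∀ m → 2 ^ m * (m ! * m !) ≤ (m + m) !
2^m*m!*m!≤[m+m]! zero = ≤-refl
2^m*m!*m!≤[m+m]! (suc m) = begin
  2 ^ suc m * (suc m ! * suc m !)                    ≡⟨ rearrange (suc m) (2 ^ m) (m !) ⟩
  (2 * suc m * suc m) * (2 ^ m * (m ! * m !))        ≤⟨ *-mono-≤ step (2^m*m!*m!≤[m+m]! m) ⟩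
  (2 + (m + m)) * (1 + (m + m)) * (m + m) !          ≡⟨ *-assoc (2 + (m + m)) (1 + (m + m)) ((m + m) !) ⟩
  (2 + (m + m)) !                                    ≡⟨ cong (λ k → suc k !) (+-suc m m) ⟨
  (suc m + suc m) !                                  ∎
  where
  open ≤-Reasoning
  rearrange : ∀ k P F → 2 * P * ((k * F) * (k * F)) ≡ (2 * k * k) * (P * (F * F))
  rearrange k P F = solve (k ∷ P ∷ F ∷ [])
  double : ∀ k → 2 * (1 + k) * (1 + k) ≡ (2 + (k + k)) * (1 + k)
  double k = solve (k ∷ [])
  step : 2 * suc m * suc m ≤ (2 + (m + m)) * (1 + (m + m))
  step = begin
    2 * (1 + m) * (1 + m)        ≡⟨ double m ⟩
    (2 + (m + m)) * suc m        ≤⟨ *-monoʳ-≤ (2 + (m + m)) (s≤s (m≤m+n m m)) ⟩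
    (2 + (m + m)) * (1 + (m + m)) ∎

prime-power∣centralBinomial⇒≤ : ∀ {r} → Prime r → ∀ m C → 0 < m → (m + m) ! ≡ C * (m ! * m !) →
                                ∀ e → r ^ e ∣ C → r ^ e ≤ m + m
prime-power∣centralBinomial⇒≤ {r} pr m C 0<m [m+m]!≡Cm!m! e rᵉ∣C
  with u₁ , m!≡ , _ ← legendre pr (m + m) m (≤-trans (m≤m+n m m) (<⇒≤ (n<m^n (m + m) (prime⇒1< pr))))
     | u₂ , [m+m]!≡ , r∤u₂ ← legendre pr (m + m) (m + m) (<⇒≤ (n<m^n (m + m) (prime⇒1< pr)))
  = begin
    r ^ e   ≤⟨ ^-monoʳ-≤ r e≤T ⟩
    r ^ T   ≤⟨ ^-powers-below≤ r (m + m) K (≤-trans 0<m (m≤m+n m m)) ⟩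
    m + m   ∎
  where
  open ≤-Reasoning
  instance
    r≢0 : NonZero r
    r≢0 = prime⇒nonZero pr
  K = m + m
  S₁ = legendreSum r K m
  S₂ = legendreSum r K (m + m)
  T = sumTo K (λ i → indicator (r ^ i ≤? m + m))
  exponent-bound : e + (S₁ + S₁) ≤ S₂
  exponent-bound = p^k∣p^e*r⇒k≤e r∤u₂ (e + (S₁ + S₁)) S₂
    (subst₂ _∣_ rᵉ⁺²ˢ (trans (sym [m+m]!≡Cm!m!) [m+m]!≡) (*-pres-∣ rᵉ∣C (*-pres-∣ rˢ∣m! rˢ∣m!)))
    where
    rˢ∣m! : r ^ S₁ ∣ m !
    rˢ∣m! = divides u₁ (trans m!≡ (*-comm (r ^ S₁) u₁))
    rᵉ⁺²ˢ : r ^ e * (r ^ S₁ * r ^ S₁) ≡ r ^ (e + (S₁ + S₁))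
    rᵉ⁺²ˢ = sym (trans (^-distribˡ-+-* r e (S₁ + S₁)) (cong (r ^ e *_) (^-distribˡ-+-* r S₁ S₁)))
  S₂≤T+2S₁ : S₂ ≤ T + (S₁ + S₁)
  S₂≤T+2S₁ = begin
    S₂
      ≤⟨ sumTo-mono-≤ K (λ i → multiples-double (r ^ i) {{m^n≢0 r i}} m) ⟩
    sumTo K (λ i → indicator (r ^ i ≤? m + m) + (multiples (r ^ i) m + multiples (r ^ i) m))
      ≡⟨ sumTo-+ K (λ i → indicator (r ^ i ≤? m + m)) _ ⟩
    T + sumTo K (λ i → multiples (r ^ i) m + multiples (r ^ i) m)
      ≡⟨ cong (T +_) (sumTo-+ K (λ i → multiples (r ^ i) m) (λ i → multiples (r ^ i) m)) ⟩
    T + (S₁ + S₁) ∎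
  e≤T : e ≤ T
  e≤T = +-cancelʳ-≤ (S₁ + S₁) e T (≤-trans exponent-bound S₂≤T+2S₁)

noPrimeDivisor⇒≤1 : ∀ n .{{_ : NonZero n}} → (∀ r → Prime r → ¬ r ∣ n) → n ≤ 1
noPrimeDivisor⇒≤1 n ∄r with factorise n
... | record { factors = [] ; isFactorisation = n≡1 } = ≤-reflexive n≡1
... | record { factors = r ∷ rs ; isFactorisation = n≡r*rs ; factorsPrime = prime-r All.∷ _ } =
  ⊥-elim (∄r r prime-r (divides (product rs) (trans n≡r*rs (*-comm r (product rs)))))

smooth-bound : ∀ B M n {{_ : NonZero n}} → 0 < B →
               (∀ r → Prime r → r ∣ n → r ≤ M) →
               (∀ r e → Prime r → r ^ e ∣ n → r ^ e ≤ B) → n ≤ B ^ M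
smooth-bound B zero n _ r≤0 _ =
  noPrimeDivisor⇒≤1 n λ r pr r∣n → <⇒≱ (<-trans z<s (prime⇒1< pr)) (r≤0 r pr r∣n)
smooth-bound B (suc M) n 0<B r≤1+M rᵉ≤B with prime? (suc M)
... | no ¬prime = ≤-trans (smooth-bound B M n 0<B r≤M rᵉ≤B) (^-monoʳ-≤ B {{>-nonZero 0<B}} (n≤1+n M))
  where
  r≤M : ∀ r → Prime r → r ∣ n → r ≤ M
  r≤M r pr r∣n = ≤-pred (≤∧≢⇒< (r≤1+M r pr r∣n) λ { refl → ¬prime pr })
... | yes prime[1+M] with e , s , n≡ , 1+M∤s ← factor-out (suc M) {{prime⇒nonTrivial prime[1+M]}} n {{it}} = begin
  n                  ≡⟨ n≡ ⟩
  suc M ^ e * s      ≤⟨ *-mono-≤ (rᵉ≤B (suc M) e prime[1+M] (divides s (trans n≡ (*-comm (suc M ^ e) s))))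
                                 (smooth-bound B M s {{s≢0}} 0<B r≤M (λ r e′ pr r^e′∣s → rᵉ≤B r e′ pr (s∣n r^e′∣s))) ⟩
  B * B ^ M          ∎
  where
  open ≤-Reasoning
  s≢0 : NonZero s
  s≢0 = m*n≢0⇒n≢0 (suc M ^ e) {{subst NonZero n≡ it}}
  s∣n : ∀ {d} → d ∣ s → d ∣ n
  s∣n d∣s = subst (_ ∣_) (sym n≡) (∣-trans d∣s (n∣m*n (suc M ^ e)))
  r≤M : ∀ r → Prime r → r ∣ s → r ≤ M
  r≤M r pr r∣s = ≤-pred (≤∧≢⇒< (r≤1+M r pr (s∣n r∣s)) λ { refl → 1+M∤s r∣s })

prime-in-range : ∀ M m → 0 < m → (m + m) ^ M < 2 ^ m → ∃[ q ] Prime q × M < q × q ≤ m + m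
prime-in-range M m 0<m bound
  with C , [m+m]!≡ ← centralBinomial m | anyUpTo? (λ q → M <? q ×-dec prime? q) (suc (m + m))
... | yes (q , q<1+2m , M<q , prime-q) = q , prime-q , M<q , ≤-pred q<1+2m
... | no ∄q = ⊥-elim (<⇒≱ bound (begin
  2 ^ m        ≤⟨ *-cancelʳ-≤ (2 ^ m) C (m ! * m !) {{m !* m !≢0}}
                    (subst (2 ^ m * (m ! * m !) ≤_) [m+m]!≡ (2^m*m!*m!≤[m+m]! m)) ⟩
  C            ≤⟨ smooth-bound (m + m) M C {{C≢0}} (≤-trans 0<m (m≤m+n m m)) r≤M rᵉ≤2m ⟩
  (m + m) ^ M  ∎))
  where
  open ≤-Reasoning
  C≢0 : NonZero C
  C≢0 = m*n≢0⇒m≢0 C {{subst NonZero [m+m]!≡ ((m + m) !≢0)}}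
  rᵉ≤2m : ∀ r e → Prime r → r ^ e ∣ C → r ^ e ≤ m + m
  rᵉ≤2m r e pr = prime-power∣centralBinomial⇒≤ pr m C 0<m [m+m]!≡ e
  r≤M : ∀ r → Prime r → r ∣ C → r ≤ M
  r≤M r pr r∣C = ≮⇒≥ λ M<r → ∄q (r , s≤s r≤2m , M<r , pr)
    where
    r≤2m : r ≤ m + m
    r≤2m = subst (_≤ m + m) (*-identityʳ r) (rᵉ≤2m r 1 pr (subst (_∣ C) (sym (*-identityʳ r)) r∣C))

prime-above : ∀ j x .{{_ : NonZero x}} → 2 ^ suc j * x < 2 ^ (2 ^ j) →
              ∃[ q ] Prime q × x < q × q ≤ 2 ^ suc j * x
prime-above j x bound =
  subst (λ y → ∃[ q ] Prime q × x < q × q ≤ y) (sym halves)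
        (prime-in-range x (2 ^ j * x) (>-nonZero⁻¹ _ {{m*n≢0 (2 ^ j) x {{m^n≢0 2 j}}}}) range)
  where
  halves : 2 ^ suc j * x ≡ 2 ^ j * x + 2 ^ j * x
  halves = double (2 ^ j) x
    where
    double : ∀ a x → 2 * a * x ≡ a * x + a * x
    double a x = solve (a ∷ x ∷ [])
  range : (2 ^ j * x + 2 ^ j * x) ^ x < 2 ^ (2 ^ j * x)
  range = begin-strict
    (2 ^ j * x + 2 ^ j * x) ^ x  ≡⟨ cong (_^ x) halves ⟨
    (2 ^ suc j * x) ^ x          <⟨ ^-monoˡ-< x bound ⟩
    (2 ^ (2 ^ j)) ^ x            ≡⟨ ^-*-assoc 2 (2 ^ j) x ⟩
    2 ^ (2 ^ j * x)              ∎
    where open ≤-Reasoning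

[n+7]²<2^[n+6] : ∀ n → (n + 7) * (n + 7) < 2 ^ (n + 6)
[n+7]²<2^[n+6] zero = from-yes (49 <? 64)
[n+7]²<2^[n+6] (suc n) = begin-strict
  (suc n + 7) * (suc n + 7)               ≡⟨ expand n ⟩
  (n + 7) * (n + 7) + (n + n + 15)        ≤⟨ +-monoʳ-≤ ((n + 7) * (n + 7)) (subst (n + n + 15 ≤_) (split n) (m≤m+n _ _)) ⟩
  (n + 7) * (n + 7) + (n + 7) * (n + 7)   <⟨ +-mono-< ([n+7]²<2^[n+6] n) ([n+7]²<2^[n+6] n) ⟩
  2 ^ (n + 6) + 2 ^ (n + 6)               ≡⟨ cong (2 ^ (n + 6) +_) (+-identityʳ (2 ^ (n + 6))) ⟨
  2 ^ (suc n + 6)                         ∎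
  where
  open ≤-Reasoning
  expand : ∀ n → (1 + n + 7) * (1 + n + 7) ≡ (n + 7) * (n + 7) + (n + n + 15)
  expand n = solve (n ∷ [])
  split : ∀ n → n + n + 15 + (n * n + 12 * n + 34) ≡ (n + 7) * (n + 7)
  split n = solve (n ∷ [])

exponent-with-room : ∀ D → ∃[ j ] suc j * D < 2 ^ j
exponent-with-room D = D + 6 , (begin-strict
  suc (D + 6) * D          ≡⟨ cong (_* D) (+-suc D 6) ⟨
  (D + 7) * D              ≤⟨ *-monoʳ-≤ (D + 7) (m≤m+n D 7) ⟩
  (D + 7) * (D + 7)        <⟨ [n+7]²<2^[n+6] D ⟩
  2 ^ (D + 6)              ∎)
  where open ≤-Reasoning

module _ (j A : ℕ) (room : suc j * (A + A + 3) < 2 ^ j) where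

  private
    split : ∀ s A → s * (A + A + 3) ≡ s + ((s + s * A) + (s + s * A))
    split s A = solve (s ∷ A ∷ [])

  p-range : 2 ^ suc j * 2 ^ (suc j * A) < 2 ^ (2 ^ j)
  p-range = begin-strict
    2 ^ suc j * 2 ^ (suc j * A)  ≡⟨ ^-distribˡ-+-* 2 (suc j) (suc j * A) ⟨
    2 ^ (suc j + suc j * A)      <⟨ ^-monoʳ-< 2 (s≤s (s≤s z≤n)) (≤-<-trans E≤ room) ⟩
    2 ^ (2 ^ j)                  ∎
    where
    open ≤-Reasoning
    E≤ : suc j + suc j * A ≤ suc j * (A + A + 3)
    E≤ = subst (suc j + suc j * A ≤_) (sym (split (suc j) A))
           (≤-trans (m≤m+n _ _) (m≤n+m _ (suc j)))

  q-range : ∀ {p m} → p ≤ 2 ^ suc j * 2 ^ (suc j * A) → m ≤ p * p → 2 ^ suc j * m < 2 ^ (2 ^ j)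
  q-range {p} {m} p≤ m≤p*p = begin-strict
    2 ^ s * m                      ≤⟨ *-monoʳ-≤ (2 ^ s) (≤-trans m≤p*p (*-mono-≤ p≤2ᴱ p≤2ᴱ)) ⟩
    2 ^ s * (2 ^ E * 2 ^ E)        ≡⟨ cong (2 ^ s *_) (^-distribˡ-+-* 2 E E) ⟨
    2 ^ s * 2 ^ (E + E)            ≡⟨ ^-distribˡ-+-* 2 s (E + E) ⟨
    2 ^ (s + (E + E))              ≡⟨ cong (2 ^_) (split s A) ⟨
    2 ^ (s * (A + A + 3))          <⟨ ^-monoʳ-< 2 (s≤s (s≤s z≤n)) room ⟩
    2 ^ (2 ^ j)                    ∎
    where
    open ≤-Reasoning
    s = suc j
    E = s + s * A
    p≤2ᴱ : p ≤ 2 ^ E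
    p≤2ᴱ = subst (p ≤_) (sym (^-distribˡ-+-* 2 s (s * A))) p≤

power-squeeze : ∀ {a b c k m p} .{{_ : NonZero a}} → c * a ≡ suc (b * b) →
                k ^ (a * b) < p → m ^ a ≤ p ^ b → (k * m) ^ b < p ^ c
power-squeeze {a} {b} {c} {k} {m} {p} ca≡1+bb kᵃᵇ<p mᵃ≤pᵇ = ^-cancelˡ-< a (begin-strict
  ((k * m) ^ b) ^ a           ≡⟨ ^-*-assoc (k * m) b a ⟩
  (k * m) ^ (b * a)           ≡⟨ cong ((k * m) ^_) (*-comm b a) ⟩
  (k * m) ^ (a * b)           ≡⟨ ^-distribʳ-* k m (a * b) ⟩
  k ^ (a * b) * m ^ (a * b)   ≡⟨ cong (k ^ (a * b) *_) (^-*-assoc m a b) ⟨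
  k ^ (a * b) * (m ^ a) ^ b   ≤⟨ *-monoʳ-≤ (k ^ (a * b)) (^-monoˡ-≤ b mᵃ≤pᵇ) ⟩
  k ^ (a * b) * (p ^ b) ^ b   <⟨ *-monoˡ-< ((p ^ b) ^ b) {{m^n≢0 (p ^ b) b {{m^n≢0 p b}}}} kᵃᵇ<p ⟩
  p * (p ^ b) ^ b             ≡⟨ cong (p *_) (^-*-assoc p b b) ⟩
  p ^ suc (b * b)             ≡⟨ cong (p ^_) ca≡1+bb ⟨
  p ^ (c * a)                 ≡⟨ ^-*-assoc p c a ⟨
  (p ^ c) ^ a                 ∎)
  where
  open ≤-Reasoning
  instance
    p≢0 : NonZero p
    p≢0 = >-nonZero (≤-<-trans z≤n kᵃᵇ<p)

m^a≤p^b⇒m≤p*p : ∀ {a b m p} .{{_ : NonZero p}} .{{_ : NonZero a}} → b ≤ a + a → m ^ a ≤ p ^ b → m ≤ p * p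
m^a≤p^b⇒m≤p*p {a} {b} {m} {p} b≤a+a mᵃ≤pᵇ = ^-cancelˡ-≤ a (begin
  m ^ a          ≤⟨ mᵃ≤pᵇ ⟩
  p ^ b          ≤⟨ ^-monoʳ-≤ p b≤a+a ⟩
  p ^ (a + a)    ≡⟨ ^-distribˡ-+-* p a a ⟩
  p ^ a * p ^ a  ≡⟨ ^-distribʳ-* p p a ⟨
  (p * p) ^ a    ∎)
  where open ≤-Reasoning

primes-between : ∀ {a b c} .{{_ : NonZero a}} → b ≤ a + a → c * a ≡ suc (b * b) →
                 ∃₂ λ p q → Prime p × Prime q × p ^ b < q ^ a × q ^ b < p ^ c
primes-between {a} {b} {c} b≤a+a ca≡1+bb
  with j , room ← exponent-with-room (a * b + a * b + 3)
  with p , prime-p , 2^sA<p , p≤ ← prime-above j (2 ^ (suc j * (a * b))) {{m^n≢0 2 (suc j * (a * b))}}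
         (p-range j (a * b) room)
  with m , 0<m , mᵃ≤pᵇ , pᵇ<[1+m]ᵃ ← integer-root a (p ^ b) (m^n>0 p {{prime⇒nonZero prime-p}} b)
  with q , prime-q , m<q , q≤ ← prime-above j m {{>-nonZero 0<m}}
         (q-range j (a * b) room p≤ (m^a≤p^b⇒m≤p*p {{prime⇒nonZero prime-p}} b≤a+a mᵃ≤pᵇ))
  = p , q , prime-p , prime-q
  , <-≤-trans pᵇ<[1+m]ᵃ (^-monoˡ-≤ a m<q)
  , ≤-<-trans (^-monoˡ-≤ b q≤) (power-squeeze {a} {b} {c} ca≡1+bb 2ˢᵃᵇ<p mᵃ≤pᵇ)
  where
  2ˢᵃᵇ<p : (2 ^ suc j) ^ (a * b) < p
  2ˢᵃᵇ<p = subst (_< p) (sym (^-*-assoc 2 (suc j) (a * b))) 2^sA<p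

theorem4p4 : (n : ℕ) → 0 < n → 2 ∣ n →
    (∃₂ λ p q → Prime p × Prime q
        × p ^ fib n < q ^ fib (n ∸ 1)
        × q ^ fib n < p ^ fib (suc n))
    × (∀ p q → Prime p → Prime q
        → p ^ fib n < q ^ fib (n ∸ 1)
        → q ^ fib n < p ^ fib (suc n)
        → CharTransformation p q (fib (suc n)) (fib n) (suc n) (fibMatrix n))
theorem4p4 n 0<n (divides zero refl) = ⊥-elim (<-irrefl refl 0<n)
theorem4p4 n _ (divides (suc M) refl) = existence , characteristic
  where
  k = M * 2
  existence : ∃₂ λ p q → Prime p × Prime q × p ^ fib n < q ^ fib (n ∸ 1) × q ^ fib n < p ^ fib (suc n)
  existence = primes-between {fib (1 + k)} {fib (2 + k)} {fib (3 + k)} {{>-nonZero (fib-pos k)}}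
    (+-monoʳ-≤ (fib (1 + k)) (fib-mono (n≤1+n k)))
    (trans (Neighbours.det (cassini-odd M)) (+-comm _ 1))
  characteristic : ∀ p q → Prime p → Prime q → p ^ fib n < q ^ fib (n ∸ 1) → q ^ fib n < p ^ fib (suc n) →
                   CharTransformation p q (fib (suc n)) (fib n) (suc n) (fibMatrix n)
  characteristic p q prime-p prime-q lower upper =
    FibonacciConvergents.charTransformation p q (prime⇒1< prime-p) (prime⇒1< prime-q) M
      (convergent-InN (1 + k) , lower) (convergent-InN (2 + k) , upper)
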